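{- Let $b,c$ be distinct integers larger than $2$ (not necessarily with $b<c$) such that each of $(2,b,c)$, $(3,b+1,c+1)$ and $(4,b+2,c+2)$ is multiplicatively dependent. If at least one of $b+1$, $c+1$ is not divisible by $3$, then one of the numbers $b,c,b+2,c+2$ is a power of $2$.
   Context: A tuple $(z_1,\dots,z_n)$ of positive integers is multiplicatively dependent if there exists a nonzero $(k_1,\dots,k_n)\in\mathbb{Z}^n$ with $z_1^{k_1}\cdots z_n^{k_n}=1$. -}

module Defs where

open import Data.Nat as ℕ using (ℕ; zero; suc; NonZero)
open import Data.Nat.Properties using (m^n≢0)
open import Data.Integer as ℤ using (ℤ; +_; -[1+_])
open import Data.Rational using (ℚ; _/_; 1ℚ; _*_)
open import Data.Fin as Fin using (Fin)
open import Data.Product using (Σ; _×_)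
open import Relation.Binary.PropositionalEquality using (_≡_)
open import Relation.Nullary using (¬_)

zpow : (z : ℕ) → .{{NonZero z}} → ℤ → ℚ
zpow z (+ n) = + (z ℕ.^ n) / 1
zpow z -[1+ n ] = (+ 1 / (z ℕ.^ suc n)) {{m^n≢0 z (suc n)}}

prodPow : ∀ n (z : Fin (suc n) → ℕ) → (∀ i → NonZero (z i)) → (Fin (suc n) → ℤ) → ℚ
prodPow n z pos k = go n z pos k
  where
  go : ∀ m (z : Fin (suc m) → ℕ) → (∀ i → NonZero (z i)) → (Fin (suc m) → ℤ) → ℚ
  go zero    z pos k = zpow (z Fin.zero) {{pos Fin.zero}} (k Fin.zero)
  go (suc m) z pos k =
    zpow (z Fin.zero) {{pos Fin.zero}} (k Fin.zero)
      * go m (λ i → z (Fin.suc i)) (λ i → pos (Fin.suc i)) (λ i → k (Fin.suc i))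

MultDep : ∀ n (z : Fin (suc n) → ℕ) → (∀ i → NonZero (z i)) → Set
MultDep n z pos = Σ (Fin (suc n) → ℤ) λ k → (¬ (∀ i → k i ≡ + 0)) × (prodPow n z pos k ≡ 1ℚ)

triple : ℕ → ℕ → ℕ → Fin 3 → ℕ
triple a b c Fin.zero = a
triple a b c (Fin.suc Fin.zero) = b
triple a b c (Fin.suc (Fin.suc Fin.zero)) = c

MultDep3 : ℕ → ℕ → ℕ → Set
MultDep3 a b c = Σ (∀ i → NonZero (triple a b c i)) λ pos → MultDep 2 (triple a b c) pos

IsPowerOf2 : ℕ → Set
IsPowerOf2 n = Σ ℕ λ e → n ≡ 2 ℕ.^ e

{-# OPTIONS --safe #-}
module Submission where

-- Unless one of b, c, b + 2, c + 2 is a power of 2, the relations for (2, b, c) and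
-- (4, b + 2, c + 2) force b, c and b + 2, c + 2 to have the same odd prime divisors. As 3
-- divides one of b, b + 1, b + 2, it then divides neither b + 1 nor c + 1, so the exponent
-- of 3 in the relation for (3, b + 1, c + 1) vanishes and (b + 1) ^ x = (c + 1) ^ y.
-- Hence b + 1 = w ^ i and c + 1 = w ^ j with i, j coprime and, say, i < j. For W = w * w
-- we get W ^ i − 1 = b (b + 2) and W ^ j − 1 = c (c + 2), so every odd prime divisor of
-- W ^ j − 1 divides W ^ i − 1 and hence W ^ gcd(i, j) − 1 = W − 1; so does 2, w being odd.
-- This contradicts an elementary case of Zsigmondy's theorem: for n ≥ 2, and 4 ∣ W − 1
-- when W is odd, W ^ n − 1 has a prime divisor not dividing W − 1. Otherwise, for a prime
-- p ∣ n and V = W ^ (n / p), every prime q dividing S = 1 + V + ⋯ + V ^ (p − 1) divides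
-- V − 1, so S ≡ p (mod q) and q = p; but S ≡ p (mod p²) and S > p.

open import Defs
open import Data.Empty using (⊥; ⊥-elim)
import Data.Fin as Fin
open import Data.Integer as ℤ using (ℤ; +_; +0; +[1+_]; -[1+_])
import Data.Integer.Properties as ℤ
open import Data.List using (_∷_)
open import Data.List.Relation.Unary.All using (_∷_)
open import Data.Nat
open import Data.Nat.Coprimality using (Coprime; coprime-divisor; coprime-/gcd)
open import Data.Nat.DivMod using (_/_; m/n*n≡m)
open import Data.Nat.Divisibility
open import Data.Nat.GCD using (gcd; gcd[m,n]∣m; gcd[m,n]∣n; gcd[m,n]≢0)
open import Data.Nat.Induction using (<-wellFounded)
open import Data.Nat.ListAction using (product)
open import Data.Nat.Primality
open import Data.Nat.Primality.Factorisation using (factorise)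
open import Data.Nat.Properties
open import Algebra.Properties.CommutativeSemigroup *-commutativeSemigroup
  using () renaming (interchange to *-interchange; x∙yz≈y∙zx to *-rotate; x∙yz≈x∙zy to *-swapʳ)
open import Data.Nat.Tactic.RingSolver using (solve-∀)
open import Data.Product as Prod using (∃-syntax; _×_; _,_; proj₁; proj₂)
open import Data.Rational as ℚ using (ℚ; toℚᵘ)
import Data.Rational.Properties as ℚ
open import Data.Rational.Unnormalised as ℚᵘ using (ℚᵘ; mkℚᵘ; *≡*) renaming (_≃_ to _≃ᵘ_; _*_ to _*ᵘ_)
import Data.Rational.Unnormalised.Properties as ℚᵘ
open import Data.Sum as Sum using (_⊎_; inj₁; inj₂)
open import Function using (_⇔_; mk⇔; Equivalence; id)
open import Function.Properties.Equivalence using () renaming (sym to ⇔-sym)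
open import Induction.WellFounded using (Acc; acc)
open import Relation.Binary.Definitions using (Tri; tri<; tri≈; tri>)
open import Relation.Binary.PropositionalEquality
open import Relation.Nullary using (¬_; yes; no)
open import Relation.Nullary.Decidable using (from-yes)

prime[3] : Prime 3
prime[3] = from-yes (prime? 3)

primeDivisor : ∀ {n} → 2 ≤ n → ∃[ q ] Prime q × q ∣ n
primeDivisor {1} (s≤s ())
primeDivisor {n@(suc (suc _))} _ with factorise n
... | record { factors = q ∷ qs ; isFactorisation = n≡∏ ; factorsPrime = q-prime ∷ _ } =
  q , q-prime , subst (q ∣_) (sym n≡∏) (m∣m*n (product qs))

prime∤1 : ∀ {p} → Prime p → ¬ p ∣ 1
prime∤1 p-prime p∣1 = ¬prime[1] (subst Prime (∣1⇒≡1 p∣1) p-prime)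

prime∣prime⇒≡ : ∀ {q p} → Prime q → Prime p → q ∣ p → q ≡ p
prime∣prime⇒≡ q-prime p-prime q∣p with prime⇒irreducible p-prime q∣p
... | inj₁ refl = ⊥-elim (¬prime[1] q-prime)
... | inj₂ q≡p  = q≡p

prime∣m^n⇒∣m×n≢0 : ∀ {q} m n → Prime q → q ∣ m ^ n → q ∣ m × n ≢ 0
prime∣m^n⇒∣m×n≢0 m zero    q-prime q∣1 = ⊥-elim (prime∤1 q-prime q∣1)
prime∣m^n⇒∣m×n≢0 m (suc n) q-prime q∣m^n with euclidsLemma m (m ^ n) q-prime q∣m^n
... | inj₁ q∣m   = q∣m , λ ()
... | inj₂ q∣m^n = proj₁ (prime∣m^n⇒∣m×n≢0 m n q-prime q∣m^n) , λ ()

prime∣p^n⇒≡p : ∀ {q p} n → Prime q → Prime p → q ∣ p ^ n → q ≡ p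
prime∣p^n⇒≡p n q-prime p-prime q∣p^n =
  prime∣prime⇒≡ q-prime p-prime (proj₁ (prime∣m^n⇒∣m×n≢0 _ n q-prime q∣p^n))

∣m⇒∣m^n : ∀ {d m} n → d ∣ m → n ≢ 0 → d ∣ m ^ n
∣m⇒∣m^n zero    _   n≢0 = ⊥-elim (n≢0 refl)
∣m⇒∣m^n (suc n) d∣m _   = ∣m⇒∣m*n _ d∣m

∣n∣1+n⇒≡1 : ∀ {d n} → d ∣ n → d ∣ 1 + n → d ≡ 1
∣n∣1+n⇒≡1 {d} {n} d∣n d∣1+n = ∣1⇒≡1 (∣m+n∣m⇒∣n (subst (d ∣_) (+-comm 1 n) d∣1+n) d∣n)

∣m∣m∸1⇒≡1 : ∀ {d m} .{{_ : NonZero m}} → d ∣ m → d ∣ m ∸ 1 → d ≡ 1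
∣m∣m∸1⇒≡1 {m = suc m} d∣m d∣m∸1 = ∣n∣1+n⇒≡1 d∣m∸1 d∣m

onlyPrimeDivisor⇒power : ∀ {p n} → n ≢ 0 → (∀ q → Prime q → q ∣ n → q ≡ p) → ∃[ e ] n ≡ p ^ e
onlyPrimeDivisor⇒power {p} {n} = go (<-wellFounded n)
  where
  go : ∀ {n} → Acc _<_ n → n ≢ 0 → (∀ q → Prime q → q ∣ n → q ≡ p) → ∃[ e ] n ≡ p ^ e
  go {0} _ n≢0 _ = ⊥-elim (n≢0 refl)
  go {1} _ _   _ = 0 , refl
  go {n@(suc (suc _))} (acc rec) _ only with primeDivisor {n} (s≤s (s≤s z≤n))
  ... | q , q-prime , q∣n@(divides m n≡m*q) with only q q-prime q∣n
  ... | refl with go (rec (quotient-< q∣n {{prime⇒nonTrivial q-prime}}))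
                    (≢-nonZero⁻¹ m {{quotient≢0 q∣n}})
                    (λ r r-prime r∣m → only r r-prime (∣-trans r∣m (quotient-∣ q∣n)))
  ... | e , m≡q^e = suc e , trans n≡m*q (trans (cong (_* q) m≡q^e) (*-comm (q ^ e) q))

onlyPrimeDivisor-p*[1+p*Y]⇒Y≡0 : ∀ {p Y} → Prime p → (∀ q → Prime q → q ∣ p * (1 + p * Y) → q ≡ p)
                               → Y ≡ 0
onlyPrimeDivisor-p*[1+p*Y]⇒Y≡0 {Y = zero} _ _ = refl
onlyPrimeDivisor-p*[1+p*Y]⇒Y≡0 {p} {suc Y} p-prime only
  with primeDivisor {1 + p * suc Y}
         (s≤s (≤-trans (<⇒≤ (nonTrivial⇒n>1 p {{prime⇒nonTrivial p-prime}})) (m≤m*n p (suc Y))))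
... | q , q-prime , q∣1+p*Y with only q q-prime (∣n⇒∣m*n p q∣1+p*Y)
... | refl = ⊥-elim (prime∤1 p-prime (∣m+n∣m⇒∣n (subst (q ∣_) (+-comm 1 _) q∣1+p*Y) (m∣m*n (suc Y))))

-- New prime divisors of W ^ n ∸ 1

geometric : ℕ → ℕ → ℕ
geometric V zero    = 0
geometric V (suc k) = 1 + V * geometric V k

triangle : ℕ → ℕ
triangle zero    = 0
triangle (suc k) = k + triangle k

[1+t]^k∸1≡t*geometric : ∀ t k → (1 + t) ^ k ∸ 1 ≡ t * geometric (1 + t) k
[1+t]^k∸1≡t*geometric t k = cong (_∸ 1) (expand k)
  where
  algebra : ∀ t g → (1 + t) * (1 + t * g) ≡ 1 + t * (1 + (1 + t) * g)
  algebra = solve-∀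
  expand : ∀ k → (1 + t) ^ k ≡ 1 + t * geometric (1 + t) k
  expand zero    = cong suc (sym (*-zeroʳ t))
  expand (suc k) = trans (cong ((1 + t) *_) (expand k)) (algebra t _)

geometric-mod : ∀ {q t} k → q ∣ t → ∃[ Y ] geometric (1 + t) k ≡ k + q * Y
geometric-mod {q} zero    _                    = 0 , sym (*-zeroʳ q)
geometric-mod {q} (suc k) q∣t@(divides a refl) with geometric-mod k q∣t
... | Y , eq = k * a + Y + a * q * Y , trans (cong (λ g → 1 + (1 + a * q) * g) eq) (algebra a q k Y)
  where
  algebra : ∀ a q k Y → 1 + (1 + a * q) * (k + q * Y) ≡ suc k + q * (k * a + Y + a * q * Y)
  algebra = solve-∀

geometric-mod² : ∀ t k → ∃[ X ] geometric (1 + t) k ≡ k + t * (triangle k + t * X)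
geometric-mod² t zero    = 0 , sym (trans (cong (t *_) (*-zeroʳ t)) (*-zeroʳ t))
geometric-mod² t (suc k) with geometric-mod² t k
... | X , eq = triangle k + X + t * X , trans (cong (λ g → 1 + (1 + t) * g) eq) (algebra t k (triangle k) X)
  where
  algebra : ∀ t k T X → 1 + (1 + t) * (k + t * (T + t * X)) ≡ suc k + t * ((k + T) + t * (T + X + t * X))
  algebra = solve-∀

∣geometric⇒∣k : ∀ {q t} k → q ∣ t → q ∣ geometric (1 + t) k → q ∣ k
∣geometric⇒∣k {q} k q∣t q∣g =
  let Y , eq = geometric-mod k q∣t
  in ∣m+n∣m⇒∣n (subst (q ∣_) (trans eq (+-comm k (q * Y))) q∣g) (m∣m*n Y)

k≤geometric : ∀ {V} k → 1 ≤ V → k ≤ geometric V k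
k≤geometric zero                _   = z≤n
k≤geometric {V@(suc _)} (suc k) V≥1 = s≤s (≤-trans (k≤geometric k V≥1) (m≤n*m _ V))

k<geometric : ∀ {V k} → 2 ≤ V → 2 ≤ k → k < geometric V k
k<geometric {k = 1} _ (s≤s ())
k<geometric {V@(suc _)} {suc k@(suc _)} V≥2 _ = s≤s (begin-strict
  k                  <⟨ m<m*n k V V≥2 ⟩
  k * V              ≡⟨ *-comm k V ⟩
  V * k              ≤⟨ *-monoʳ-≤ V (k≤geometric k (s≤s z≤n)) ⟩
  V * geometric V k  ∎)
  where open ≤-Reasoning

2*triangle+k≡k*k : ∀ k → 2 * triangle k + k ≡ k * k
2*triangle+k≡k*k zero    = refl
2*triangle+k≡k*k (suc k) = begin
  2 * (k + triangle k) + suc k       ≡⟨ regroup k (triangle k) ⟩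
  (2 * triangle k + k) + (2 * k + 1) ≡⟨ cong (_+ (2 * k + 1)) (2*triangle+k≡k*k k) ⟩
  k * k + (2 * k + 1)                ≡⟨ square k ⟩
  suc k * suc k                      ∎
  where
  open ≡-Reasoning
  regroup : ∀ k T → 2 * (k + T) + suc k ≡ (2 * T + k) + (2 * k + 1)
  regroup = solve-∀
  square : ∀ k → k * k + (2 * k + 1) ≡ suc k * suc k
  square = solve-∀

prime∣triangle : ∀ {p} → Prime p → p ≢ 2 → p ∣ triangle p
prime∣triangle {p} p-prime p≢2 with euclidsLemma 2 (triangle p) p-prime p∣2*triangle
  where
  p∣2*triangle : p ∣ 2 * triangle p
  p∣2*triangle = ∣m+n∣m⇒∣n (subst (p ∣_) (trans (sym (2*triangle+k≡k*k p)) (+-comm _ p)) (m∣m*n p)) ∣-refl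
... | inj₁ p∣2 = ⊥-elim (p≢2 (prime∣prime⇒≡ p-prime prime[2] p∣2))
... | inj₂ p∣T = p∣T

-- Modulo t², the sum is p + t * triangle p, and p * p ∣ t * triangle p: for odd p since
-- p ∣ t and p ∣ triangle p, for p = 2 since 4 ∣ t.
geometric-mod-p² : ∀ {p t} → Prime p → p ∣ t → (p ≡ 2 → 4 ∣ t)
                 → ∃[ Y ] geometric (1 + t) p ≡ p * (1 + p * Y)
geometric-mod-p² {p} {t} p-prime p∣t 4∣t =
  let X , eqX = geometric-mod² t p
      divides Y eqY = p*p∣t*[T+t*X] X
  in Y , trans eqX (trans (cong (λ x → p + x) eqY) (algebra p Y))
  where
  p*p∣t*[T+t*X] : ∀ X → p * p ∣ t * (triangle p + t * X)
  p*p∣t*[T+t*X] X with p ≟ 2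
  ... | yes refl = ∣m⇒∣m*n _ (4∣t refl)
  ... | no  p≢2  = *-pres-∣ p∣t (∣m∣n⇒∣m+n (prime∣triangle p-prime p≢2) (∣m⇒∣m*n X p∣t))
  algebra : ∀ p Y → p + Y * (p * p) ≡ p * (1 + p * Y)
  algebra = solve-∀

geometric-hasNewPrimeDivisor : ∀ {p d t} → Prime p → 1 ≤ t → d ∣ t → (2 ∣ d → 4 ∣ d)
                             → ¬ (∀ q → Prime q → q ∣ geometric (1 + t) p → q ∣ d)
geometric-hasNewPrimeDivisor {p} {d} {t} p-prime t≥1 d∣t 2∣d⇒4∣d old =
  S≢p*[1+p*Y] (geometric-mod-p² p-prime p∣t 4∣t)
  where
  S : ℕ
  S = geometric (1 + t) p
  p≥2 : 2 ≤ p
  p≥2 = nonTrivial⇒n>1 p {{prime⇒nonTrivial p-prime}}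
  only-p : ∀ q → Prime q → q ∣ S → q ≡ p
  only-p q q-prime q∣S =
    prime∣prime⇒≡ q-prime p-prime (∣geometric⇒∣k p (∣-trans (old q q-prime q∣S) d∣t) q∣S)
  p<S : p < S
  p<S = k<geometric (s≤s t≥1) p≥2
  p∣S : p ∣ S
  p∣S with primeDivisor (≤-trans p≥2 (<⇒≤ p<S))
  ... | q , q-prime , q∣S = subst (_∣ S) (only-p q q-prime q∣S) q∣S
  p∣d : p ∣ d
  p∣d = old p p-prime p∣S
  p∣t : p ∣ t
  p∣t = ∣-trans p∣d d∣t
  4∣t : p ≡ 2 → 4 ∣ t
  4∣t refl = ∣-trans (2∣d⇒4∣d p∣d) d∣t
  S≢p*[1+p*Y] : ¬ (∃[ Y ] S ≡ p * (1 + p * Y))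
  S≢p*[1+p*Y] (Y , S≡p*[1+p*Y])
    with onlyPrimeDivisor-p*[1+p*Y]⇒Y≡0 p-prime
           (λ q q-prime q∣ → only-p q q-prime (subst (q ∣_) (sym S≡p*[1+p*Y]) q∣))
  ... | refl = <-irrefl (sym (trans S≡p*[1+p*Y] (trans (cong (λ x → p * suc x) (*-zeroʳ p)) (*-identityʳ p)))) p<S

^∸1-hasNewPrimeDivisor : ∀ {W n} → 2 ≤ W → 2 ≤ n → (2 ∣ W ∸ 1 → 4 ∣ W ∸ 1)
                       → ¬ (∀ q → Prime q → q ∣ W ^ n ∸ 1 → q ∣ W ∸ 1)
^∸1-hasNewPrimeDivisor {W@(suc w)} W≥2 n≥2 2∣w⇒4∣w old with primeDivisor n≥2
^∸1-hasNewPrimeDivisor W≥2 () _ _ | _ , _ , divides zero refl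
... | p , p-prime , divides m@(suc m′) refl =
  geometric-hasNewPrimeDivisor p-prime t≥1 w∣t 2∣w⇒4∣w
    (λ q q-prime q∣S → old q q-prime (∣-trans q∣S S∣W^n∸1))
  where
  instance
    W^m≢0 : NonZero (W ^ m)
    W^m≢0 = m^n≢0 W m
  t : ℕ
  t = W ^ m ∸ 1
  t≥1 : 1 ≤ t
  t≥1 = ≤-pred (subst (2 ≤_) (sym (suc-pred (W ^ m))) (≤-trans W≥2 (m≤m*n W (W ^ m′) {{m^n≢0 W m′}})))
  W^n∸1≡t*S : W ^ (m * p) ∸ 1 ≡ t * geometric (1 + t) p
  W^n∸1≡t*S = begin
    W ^ (m * p) ∸ 1  ≡⟨ cong (_∸ 1) (^-*-assoc W m p) ⟨
    (W ^ m) ^ p ∸ 1  ≡⟨ cong (λ V → V ^ p ∸ 1) (suc-pred (W ^ m)) ⟨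
    (1 + t) ^ p ∸ 1  ≡⟨ [1+t]^k∸1≡t*geometric t p ⟩
    t * geometric (1 + t) p ∎
    where open ≡-Reasoning
  S∣W^n∸1 : geometric (1 + t) p ∣ W ^ (m * p) ∸ 1
  S∣W^n∸1 = subst (geometric (1 + t) p ∣_) (sym W^n∸1≡t*S) (n∣m*n t)
  w∣t : w ∣ t
  w∣t = subst (w ∣_) (sym ([1+t]^k∸1≡t*geometric w m)) (m∣m*n _)

-- Equal powers have a common base

-- The pairs reachable from (1 , 1) by Euclid's moves, i.e. the coprime pairs.
data Reachable : ℕ → ℕ → Set where
  one  : Reachable 1 1
  step : ∀ {i k} → Reachable i k → Reachable i (i + k)
  swap : ∀ {i j} → Reachable i j → Reachable j i

reachable⇒≥1 : ∀ {i j} → Reachable i j → 1 ≤ i × 1 ≤ j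
reachable⇒≥1 one      = s≤s z≤n , s≤s z≤n
reachable⇒≥1 (step r) = proj₁ (reachable⇒≥1 r) , ≤-trans (proj₁ (reachable⇒≥1 r)) (m≤m+n _ _)
reachable⇒≥1 (swap r) = proj₂ (reachable⇒≥1 r) , proj₁ (reachable⇒≥1 r)

m*n∸1≡[m∸1]*n+[n∸1] : ∀ m n .{{_ : NonZero m}} .{{_ : NonZero n}} → m * n ∸ 1 ≡ (m ∸ 1) * n + (n ∸ 1)
m*n∸1≡[m∸1]*n+[n∸1] (suc m) (suc n) = +-comm n (m * suc n)

∣^∸1-reachable : ∀ {W d i j} .{{_ : NonZero W}} → Reachable i j
               → d ∣ W ^ i ∸ 1 → d ∣ W ^ j ∸ 1 → d ∣ W ∸ 1
∣^∸1-reachable {W} one d∣W^1∸1 _ = subst (λ x → _ ∣ x ∸ 1) (*-identityʳ W) d∣W^1∸1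
∣^∸1-reachable {W} {d} (step {i} {k} r) d∣W^i∸1 d∣W^[i+k]∸1 = ∣^∸1-reachable r d∣W^i∸1 d∣W^k∸1
  where
  instance
    W^i≢0 : NonZero (W ^ i)
    W^i≢0 = m^n≢0 W i
    W^k≢0 : NonZero (W ^ k)
    W^k≢0 = m^n≢0 W k
  W^[i+k]∸1≡ : W ^ (i + k) ∸ 1 ≡ (W ^ i ∸ 1) * W ^ k + (W ^ k ∸ 1)
  W^[i+k]∸1≡ = trans (cong (_∸ 1) (^-distribˡ-+-* W i k)) (m*n∸1≡[m∸1]*n+[n∸1] (W ^ i) (W ^ k))
  d∣W^k∸1 : d ∣ W ^ k ∸ 1
  d∣W^k∸1 = ∣m+n∣m⇒∣n (subst (d ∣_) W^[i+k]∸1≡ d∣W^[i+k]∸1) (∣m⇒∣m*n (W ^ k) d∣W^i∸1)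
∣^∸1-reachable (swap r) d∣W^i∸1 d∣W^j∸1 = ∣^∸1-reachable r d∣W^j∸1 d∣W^i∸1

^-distribʳ-* : ∀ m n k → (m * n) ^ k ≡ m ^ k * n ^ k
^-distribʳ-* m n zero    = refl
^-distribʳ-* m n (suc k) = trans (cong ((m * n) *_) (^-distribʳ-* m n k)) (*-interchange m n (m ^ k) (n ^ k))

coprime-^ : ∀ {m n} k → Coprime m n → Coprime m (n ^ k)
coprime-^ zero    _   (_ , d∣1) = ∣1⇒≡1 d∣1
coprime-^ {m} {n} (suc k) m⊥n {d} (d∣m , d∣n*n^k) = coprime-^ k m⊥n (d∣m , coprime-divisor d⊥n d∣n*n^k)
  where
  d⊥n : Coprime d n
  d⊥n (e∣d , e∣n) = m⊥n (∣-trans e∣d d∣m , e∣n)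

m^n∣o^n⇒m∣o : ∀ {m o} n .{{_ : NonZero n}} .{{_ : NonZero m}} → m ^ n ∣ o ^ n → m ∣ o
m^n∣o^n⇒m∣o {m} {o} n m^n∣o^n = subst (_∣ o) g≡m (gcd[m,n]∣n m o)
  where
  g : ℕ
  g = gcd m o
  instance
    g≢0 : NonZero g
    g≢0 = ≢-nonZero (gcd[m,n]≢0 m o (inj₁ (≢-nonZero⁻¹ m)))
    g^n≢0 : NonZero (g ^ n)
    g^n≢0 = m^n≢0 g n
  split : ∀ {x} → g ∣ x → x ^ n ≡ (x / g) ^ n * g ^ n
  split {x} g∣x = trans (cong (_^ n) (sym (m/n*n≡m g∣x))) (^-distribʳ-* (x / g) g n)
  m∣m^n : ∀ {x} n .{{_ : NonZero n}} → x ∣ x ^ n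
  m∣m^n (suc n) = m∣m*n _
  [m/g]^n∣[o/g]^n : (m / g) ^ n ∣ (o / g) ^ n
  [m/g]^n∣[o/g]^n = *-cancelʳ-∣ (g ^ n) (subst₂ _∣_ (split (gcd[m,n]∣m m o)) (split (gcd[m,n]∣n m o)) m^n∣o^n)
  m/g≡1 : m / g ≡ 1
  m/g≡1 = coprime-^ n (coprime-/gcd m o) (∣-refl , ∣-trans (m∣m^n n) [m/g]^n∣[o/g]^n)
  g≡m : g ≡ m
  g≡m = trans (sym (*-identityˡ g)) (trans (cong (_* g) (sym m/g≡1)) (m/n*n≡m (gcd[m,n]∣m m o)))

record PowersOfCommonBase (B C : ℕ) : Set where
  field
    base i j  : ℕ
    reachable : Reachable i j
    B≡base^i  : B ≡ base ^ i
    C≡base^j  : C ≡ base ^ j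

swapPowers : ∀ {B C} → PowersOfCommonBase B C → PowersOfCommonBase C B
swapPowers P = record { reachable = swap reachable ; B≡base^i = C≡base^j ; C≡base^j = B≡base^i }
  where open PowersOfCommonBase P

multiplyPowers : ∀ {B C D} → C ≡ D * B → PowersOfCommonBase B D → PowersOfCommonBase B C
multiplyPowers {B} {C} {D} C≡D*B P = record { reachable = step reachable ; B≡base^i = B≡base^i ; C≡base^j = C≡ }
  where
  open PowersOfCommonBase P
  open ≡-Reasoning
  C≡ : C ≡ base ^ (i + j)
  C≡ = begin
    C                    ≡⟨ C≡D*B ⟩
    D * B                ≡⟨ cong₂ _*_ C≡base^j B≡base^i ⟩
    base ^ j * base ^ i  ≡⟨ *-comm (base ^ j) (base ^ i) ⟩
    base ^ i * base ^ j  ≡⟨ ^-distribˡ-+-* base i j ⟨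
    base ^ (i + j)       ∎

exponent≥1 : ∀ {B C x y} → 2 ≤ C → 1 ≤ y → B ^ x ≡ C ^ y → 1 ≤ x
exponent≥1 {x = suc _} _ _ _ = s≤s z≤n
exponent≥1 {C = C} {zero} {suc y} (s≤s (s≤s _)) _ 1≡C^y with m^n≡1⇒n≡0∨m≡1 C (suc y) (sym 1≡C^y)
... | inj₁ ()
... | inj₂ ()

quotientPower : ∀ {B C x y} → 2 ≤ B → B < C → 1 ≤ y → B ^ x ≡ C ^ y
              → ∃[ D ] C ≡ D * B × B ^ (x ∸ y) ≡ D ^ y
quotientPower {B@(suc _)} {C} {x} {y@(suc _)} B≥2 B<C _ B^x≡C^y = D , C≡D*B , B^[x∸y]≡D^y
  where
  instance
    B^y≢0 : NonZero (B ^ y)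
    B^y≢0 = m^n≢0 B y
  y≤x : y ≤ x
  y≤x = ≮⇒≥ λ x<y → <-irrefl B^x≡C^y (begin-strict
    B ^ x  ≤⟨ ^-monoʳ-≤ B (<⇒≤ x<y) ⟩
    B ^ y  <⟨ ^-monoˡ-< y B<C ⟩
    C ^ y  ∎)
    where open ≤-Reasoning
  B^y*B^[x∸y]≡C^y : B ^ y * B ^ (x ∸ y) ≡ C ^ y
  B^y*B^[x∸y]≡C^y = trans (sym (^-distribˡ-+-* B y (x ∸ y))) (trans (cong (B ^_) (m+[n∸m]≡n y≤x)) B^x≡C^y)
  B∣C : B ∣ C
  B∣C = m^n∣o^n⇒m∣o y (divides (B ^ (x ∸ y)) (trans (sym B^y*B^[x∸y]≡C^y) (*-comm (B ^ y) _)))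
  D : ℕ
  D = quotient B∣C
  C≡D*B : C ≡ D * B
  C≡D*B = m∣n⇒n≡quotient*m B∣C
  B^[x∸y]≡D^y : B ^ (x ∸ y) ≡ D ^ y
  B^[x∸y]≡D^y = *-cancelˡ-≡ _ _ (B ^ y) (begin
    B ^ y * B ^ (x ∸ y)  ≡⟨ B^y*B^[x∸y]≡C^y ⟩
    C ^ y                ≡⟨ cong (_^ y) C≡D*B ⟩
    (D * B) ^ y          ≡⟨ ^-distribʳ-* D B y ⟩
    D ^ y * B ^ y        ≡⟨ *-comm (D ^ y) (B ^ y) ⟩
    B ^ y * D ^ y        ∎)
    where open ≡-Reasoning

powersOfCommonBase-≤ : ∀ {B C x y} → Acc _<_ C → 2 ≤ B → B ≤ C → 1 ≤ x → 1 ≤ y → B ^ x ≡ C ^ y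
                     → PowersOfCommonBase B C
powersOfCommonBase-≤ {B} (acc rec) B≥2 B≤C x≥1 y≥1 B^x≡C^y with m≤n⇒m<n∨m≡n B≤C
... | inj₂ refl =
  record { base = B ; reachable = one ; B≡base^i = sym (*-identityʳ B) ; C≡base^j = sym (*-identityʳ B) }
... | inj₁ B<C with quotientPower B≥2 B<C y≥1 B^x≡C^y
powersOfCommonBase-≤ {B} {C} {x} {y} (acc rec) B≥2 _ _ y≥1 _ | inj₁ B<C | D , C≡D*B , B^x′≡D^y =
  multiplyPowers C≡D*B (recurse (≤-total B D))
  where
  D≥2 : 2 ≤ D
  D≥2 = *-cancelʳ-< B 1 D (subst₂ _<_ (sym (*-identityˡ B)) C≡D*B B<C)
  D<C : D < C
  D<C = subst (D <_) (sym C≡D*B) (m<m*n D B {{>-nonZero (<-trans (s≤s z≤n) D≥2)}} B≥2)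
  x′≥1 : 1 ≤ x ∸ y
  x′≥1 = exponent≥1 D≥2 y≥1 B^x′≡D^y
  recurse : B ≤ D ⊎ D ≤ B → PowersOfCommonBase B D
  recurse (inj₁ B≤D) = powersOfCommonBase-≤ (rec D<C) B≥2 B≤D x′≥1 y≥1 B^x′≡D^y
  recurse (inj₂ D≤B) = swapPowers (powersOfCommonBase-≤ (rec B<C) D≥2 D≤B y≥1 x′≥1 (sym B^x′≡D^y))

powersOfCommonBase : ∀ {B C x y} → 2 ≤ B → 2 ≤ C → 1 ≤ x → 1 ≤ y → B ^ x ≡ C ^ y
                   → PowersOfCommonBase B C
powersOfCommonBase {B} {C} B≥2 C≥2 x≥1 y≥1 B^x≡C^y with ≤-total B C
... | inj₁ B≤C = powersOfCommonBase-≤ (<-wellFounded C) B≥2 B≤C x≥1 y≥1 B^x≡C^y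
... | inj₂ C≤B = swapPowers (powersOfCommonBase-≤ (<-wellFounded B) C≥2 C≤B y≥1 x≥1 (sym B^x≡C^y))

-- Multiplicatively dependent triples

infix 10 _⁺ _⁻

_⁺ : ℤ → ℕ
(+ n)    ⁺ = n
-[1+ n ] ⁺ = 0

_⁻ : ℤ → ℕ
(+ n)    ⁻ = 0
-[1+ n ] ⁻ = suc n

⁺≢0⇒⁻≡0 : ∀ k → k ⁺ ≢ 0 → k ⁻ ≡ 0
⁺≢0⇒⁻≡0 (+ n)    _    = refl
⁺≢0⇒⁻≡0 -[1+ n ] k⁺≢0 = ⊥-elim (k⁺≢0 refl)

⁻≢0⇒⁺≡0 : ∀ k → k ⁻ ≢ 0 → k ⁺ ≡ 0
⁻≢0⇒⁺≡0 (+ n)    k⁻≢0 = ⊥-elim (k⁻≢0 refl)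
⁻≢0⇒⁺≡0 -[1+ n ] _    = refl

≢0⇒⁺≢0⊎⁻≢0 : ∀ {k} → k ≢ + 0 → k ⁺ ≢ 0 ⊎ k ⁻ ≢ 0
≢0⇒⁺≢0⊎⁻≢0 {+0}       k≢0 = ⊥-elim (k≢0 refl)
≢0⇒⁺≢0⊎⁻≢0 {+[1+ n ]} _   = inj₁ λ ()
≢0⇒⁺≢0⊎⁻≢0 { -[1+ n ]} _  = inj₂ λ ()

⁺-neg : ∀ k → (ℤ.- k) ⁺ ≡ k ⁻
⁺-neg +0       = refl
⁺-neg +[1+ n ] = refl
⁺-neg -[1+ n ] = refl

⁻-neg : ∀ k → (ℤ.- k) ⁻ ≡ k ⁺
⁻-neg +0       = refl
⁻-neg +[1+ n ] = refl
⁻-neg -[1+ n ] = refl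

-- a ^ k₀ * u ^ k₁ * v ^ k₂ = 1 in ℚ, with the negative powers moved to the right-hand side.
record Dependence (a u v : ℕ) : Set where
  field
    k₀ k₁ k₂   : ℤ
    nontrivial : ¬ (k₀ ≡ + 0 × k₁ ≡ + 0 × k₂ ≡ + 0)
    balanced   : a ^ k₀ ⁺ * (u ^ k₁ ⁺ * v ^ k₂ ⁺) ≡ a ^ k₀ ⁻ * (u ^ k₁ ⁻ * v ^ k₂ ⁻)

open Dependence

zpowᵘ : ℕ → ℤ → ℚᵘ
zpowᵘ z k = mkℚᵘ (+ (z ^ k ⁺)) (pred (z ^ k ⁻))

toℚᵘ-/ : ∀ i d .{{_ : NonZero d}} → toℚᵘ (i ℚ./ d) ≃ᵘ mkℚᵘ i (pred d)
toℚᵘ-/ i (suc d) = ℚ.toℚᵘ-fromℚᵘ (mkℚᵘ i d)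

toℚᵘ-zpow : ∀ z .{{_ : NonZero z}} k → toℚᵘ (zpow z k) ≃ᵘ zpowᵘ z k
toℚᵘ-zpow z (+ n)    = toℚᵘ-/ (+ (z ^ n)) 1
toℚᵘ-zpow z -[1+ n ] = toℚᵘ-/ (+ 1) (z ^ suc n) {{m^n≢0 z (suc n)}}

fractions≃1 : ∀ n₁ n₂ n₃ d₁ d₂ d₃ .{{_ : NonZero d₁}} .{{_ : NonZero d₂}} .{{_ : NonZero d₃}}
            → mkℚᵘ (+ n₁) (pred d₁) *ᵘ (mkℚᵘ (+ n₂) (pred d₂) *ᵘ mkℚᵘ (+ n₃) (pred d₃))
              ≃ᵘ ℚᵘ.1ℚᵘ
            → n₁ * (n₂ * n₃) ≡ d₁ * (d₂ * d₃)
fractions≃1 n₁ n₂ n₃ (suc d₁) (suc d₂) (suc d₃) (*≡* eq) = ℤ.+-injective (begin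
  + (n₁ * (n₂ * n₃))                      ≡⟨ ℤ.pos-* n₁ (n₂ * n₃) ⟩
  + n₁ ℤ.* + (n₂ * n₃)                    ≡⟨ cong (+ n₁ ℤ.*_) (ℤ.pos-* n₂ n₃) ⟩
  + n₁ ℤ.* (+ n₂ ℤ.* + n₃)                ≡⟨ ℤ.*-identityʳ _ ⟨
  (+ n₁ ℤ.* (+ n₂ ℤ.* + n₃)) ℤ.* + 1      ≡⟨ eq ⟩
  + 1 ℤ.* + (suc d₁ * (suc d₂ * suc d₃))  ≡⟨ ℤ.*-identityˡ _ ⟩
  + (suc d₁ * (suc d₂ * suc d₃))          ∎)
  where open ≡-Reasoning

fromMultDep3 : ∀ {a u v} → MultDep3 a u v → Dependence a u v
fromMultDep3 {a} {u} {v} (pos , k , k≢0 , product≡1) = record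
  { k₀ = k i₀ ; k₁ = k i₁ ; k₂ = k i₂
  ; nontrivial = λ (k₀≡0 , k₁≡0 , k₂≡0) → k≢0 λ
      { Fin.zero → k₀≡0 ; (Fin.suc Fin.zero) → k₁≡0 ; (Fin.suc (Fin.suc Fin.zero)) → k₂≡0 }
  ; balanced = fractions≃1 (a ^ k i₀ ⁺) (u ^ k i₁ ⁺) (v ^ k i₂ ⁺) (a ^ k i₀ ⁻) (u ^ k i₁ ⁻) (v ^ k i₂ ⁻)
                 {{m^n≢0 a (k i₀ ⁻) {{pos i₀}}}} {{m^n≢0 u (k i₁ ⁻) {{pos i₁}}}}
                 {{m^n≢0 v (k i₂ ⁻) {{pos i₂}}}} product≃1
  }
  where
  i₀ i₁ i₂ : Fin.Fin 3
  i₀ = Fin.zero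
  i₁ = Fin.suc Fin.zero
  i₂ = Fin.suc (Fin.suc Fin.zero)
  x y z : ℚ
  x = zpow a {{pos i₀}} (k i₀)
  y = zpow u {{pos i₁}} (k i₁)
  z = zpow v {{pos i₂}} (k i₂)
  product≃1 : zpowᵘ a (k i₀) *ᵘ (zpowᵘ u (k i₁) *ᵘ zpowᵘ v (k i₂)) ≃ᵘ ℚᵘ.1ℚᵘ
  product≃1 = begin
    zpowᵘ a (k i₀) *ᵘ (zpowᵘ u (k i₁) *ᵘ zpowᵘ v (k i₂))
      ≈⟨ ℚᵘ.*-cong (toℚᵘ-zpow a {{pos i₀}} (k i₀))
                   (ℚᵘ.*-cong (toℚᵘ-zpow u {{pos i₁}} (k i₁)) (toℚᵘ-zpow v {{pos i₂}} (k i₂))) ⟨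
    toℚᵘ x *ᵘ (toℚᵘ y *ᵘ toℚᵘ z) ≈⟨ ℚᵘ.*-congˡ {toℚᵘ x} (ℚ.toℚᵘ-homo-* y z) ⟨
    toℚᵘ x *ᵘ toℚᵘ (y ℚ.* z)     ≈⟨ ℚ.toℚᵘ-homo-* x (y ℚ.* z) ⟨
    toℚᵘ (x ℚ.* (y ℚ.* z))       ≈⟨ ℚ.toℚᵘ-cong product≡1 ⟩
    ℚᵘ.1ℚᵘ                        ∎
    where open ℚᵘ.≃-Reasoning

negate : ∀ {a u v} → Dependence a u v → Dependence a u v
negate {a} {u} {v} d = record
  { k₀ = ℤ.- k₀ d ; k₁ = ℤ.- k₁ d ; k₂ = ℤ.- k₂ d
  ; nontrivial = λ (e₀ , e₁ , e₂) → nontrivial d (neg≡0 e₀ , neg≡0 e₁ , neg≡0 e₂)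
  ; balanced = negated
  }
  where
  neg≡0 : ∀ {k} → ℤ.- k ≡ + 0 → k ≡ + 0
  neg≡0 = ℤ.neg-injective {j = + 0}
  negated : a ^ (ℤ.- k₀ d) ⁺ * (u ^ (ℤ.- k₁ d) ⁺ * v ^ (ℤ.- k₂ d) ⁺)
          ≡ a ^ (ℤ.- k₀ d) ⁻ * (u ^ (ℤ.- k₁ d) ⁻ * v ^ (ℤ.- k₂ d) ⁻)
  negated rewrite ⁺-neg (k₀ d) | ⁺-neg (k₁ d) | ⁺-neg (k₂ d)
                | ⁻-neg (k₀ d) | ⁻-neg (k₁ d) | ⁻-neg (k₂ d) = sym (balanced d)

rotate : ∀ {a u v} → Dependence a u v → Dependence u v a
rotate {a} {u} {v} d = record
  { k₀ = k₁ d ; k₁ = k₂ d ; k₂ = k₀ d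
  ; nontrivial = λ (e₁ , e₂ , e₀) → nontrivial d (e₀ , e₁ , e₂)
  ; balanced = trans (sym (*-rotate (a ^ k₀ d ⁺) (u ^ k₁ d ⁺) (v ^ k₂ d ⁺)))
                 (trans (balanced d) (*-rotate (a ^ k₀ d ⁻) (u ^ k₁ d ⁻) (v ^ k₂ d ⁻)))
  }

swap₁₂ : ∀ {a u v} → Dependence a u v → Dependence a v u
swap₁₂ {a} {u} {v} d = record
  { k₀ = k₀ d ; k₁ = k₂ d ; k₂ = k₁ d
  ; nontrivial = λ (e₀ , e₂ , e₁) → nontrivial d (e₀ , e₁ , e₂)
  ; balanced = trans (sym (*-swapʳ (a ^ k₀ d ⁺) (u ^ k₁ d ⁺) (v ^ k₂ d ⁺)))
                 (trans (balanced d) (*-swapʳ (a ^ k₀ d ⁻) (u ^ k₁ d ⁻) (v ^ k₂ d ⁻)))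
  }

prime∣monomial : ∀ {q a u v e₀ e₁ e₂} → Prime q → q ∣ a ^ e₀ * (u ^ e₁ * v ^ e₂)
               → (q ∣ a × e₀ ≢ 0) ⊎ (q ∣ u × e₁ ≢ 0) ⊎ (q ∣ v × e₂ ≢ 0)
prime∣monomial {q} {a} {u} {v} {e₀} {e₁} {e₂} q-prime q∣m with euclidsLemma (a ^ e₀) _ q-prime q∣m
... | inj₁ q∣a^e₀ = inj₁ (prime∣m^n⇒∣m×n≢0 a e₀ q-prime q∣a^e₀)
... | inj₂ q∣rest with euclidsLemma (u ^ e₁) (v ^ e₂) q-prime q∣rest
...   | inj₁ q∣u^e₁ = inj₂ (inj₁ (prime∣m^n⇒∣m×n≢0 u e₁ q-prime q∣u^e₁))
...   | inj₂ q∣v^e₂ = inj₂ (inj₂ (prime∣m^n⇒∣m×n≢0 v e₂ q-prime q∣v^e₂))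

prime∣a⇒∣u⁻⊎∣v⁻ : ∀ {a u v q} (d : Dependence a u v) → Prime q → q ∣ a → k₀ d ⁺ ≢ 0
                → (q ∣ u × k₁ d ⁻ ≢ 0) ⊎ (q ∣ v × k₂ d ⁻ ≢ 0)
prime∣a⇒∣u⁻⊎∣v⁻ {q = q} d q-prime q∣a k₀⁺≢0
  with prime∣monomial q-prime
         (subst (q ∣_) (balanced d) (∣m⇒∣m*n _ (∣m⇒∣m^n (k₀ d ⁺) q∣a k₀⁺≢0)))
... | inj₁ (_ , k₀⁻≢0) = ⊥-elim (k₀⁻≢0 (⁺≢0⇒⁻≡0 (k₀ d) k₀⁺≢0))
... | inj₂ q∣u⊎q∣v     = q∣u⊎q∣v

prime∣a⇒∣u⊎∣v : ∀ {a u v q} (d : Dependence a u v) → Prime q → q ∣ a → k₀ d ≢ + 0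
              → (q ∣ u × k₁ d ≢ + 0) ⊎ (q ∣ v × k₂ d ≢ + 0)
prime∣a⇒∣u⊎∣v d q-prime q∣a k₀≢0 with ≢0⇒⁺≢0⊎⁻≢0 k₀≢0
... | inj₁ k₀⁺≢0 =
  Sum.map (Prod.map₂ ⁻≢0⇒≢0) (Prod.map₂ ⁻≢0⇒≢0) (prime∣a⇒∣u⁻⊎∣v⁻ d q-prime q∣a k₀⁺≢0)
  where
  ⁻≢0⇒≢0 : ∀ {k} → k ⁻ ≢ 0 → k ≢ + 0
  ⁻≢0⇒≢0 k⁻≢0 refl = k⁻≢0 refl
... | inj₂ k₀⁻≢0 =
  Sum.map (Prod.map₂ -k⁻≢0⇒≢0) (Prod.map₂ -k⁻≢0⇒≢0)
    (prime∣a⇒∣u⁻⊎∣v⁻ (negate d) q-prime q∣a (λ eq → k₀⁻≢0 (trans (sym (⁺-neg (k₀ d))) eq)))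
  where
  -k⁻≢0⇒≢0 : ∀ {k} → (ℤ.- k) ⁻ ≢ 0 → k ≢ + 0
  -k⁻≢0⇒≢0 -k⁻≢0 refl = -k⁻≢0 refl

¬k₁≡0×k₂≡0 : ∀ {a u v q} (d : Dependence a u v) → Prime q → q ∣ a → ¬ (k₁ d ≡ + 0 × k₂ d ≡ + 0)
¬k₁≡0×k₂≡0 d q-prime q∣a (k₁≡0 , k₂≡0)
  with prime∣a⇒∣u⊎∣v d q-prime q∣a (λ k₀≡0 → nontrivial d (k₀≡0 , k₁≡0 , k₂≡0))
... | inj₁ (_ , k₁≢0) = k₁≢0 k₁≡0
... | inj₂ (_ , k₂≢0) = k₂≢0 k₂≡0

k₀≡0⇒k₁≢0 : ∀ {a u v} (d : Dependence a u v) → 2 ≤ v → k₀ d ≡ + 0 → k₁ d ≢ + 0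
k₀≡0⇒k₁≢0 d v≥2 k₀≡0 k₁≡0 with primeDivisor v≥2
... | q , q-prime , q∣v
  with prime∣a⇒∣u⊎∣v (rotate (swap₁₂ d)) q-prime q∣v (λ k₂≡0 → nontrivial d (k₀≡0 , k₁≡0 , k₂≡0))
...   | inj₁ (_ , k₁≢0) = k₁≢0 k₁≡0
...   | inj₂ (_ , k₀≢0) = k₀≢0 k₀≡0

SamePrimeDivisorsExcept : ℕ → ℕ → ℕ → Set
SamePrimeDivisorsExcept p u v = ∀ q → Prime q → q ≢ p → q ∣ u ⇔ q ∣ v

samePrimeDivisors-sym : ∀ {p u v} → SamePrimeDivisorsExcept p u v → SamePrimeDivisorsExcept p v u
samePrimeDivisors-sym S q q-prime q≢p = ⇔-sym (S q q-prime q≢p)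

samePrimeDivisors-* : ∀ {p u v u′ v′} → SamePrimeDivisorsExcept p u v → SamePrimeDivisorsExcept p u′ v′
                    → SamePrimeDivisorsExcept p (u * u′) (v * v′)
samePrimeDivisors-* S S′ q q-prime q≢p =
  mk⇔ (combine (Equivalence.to (S q q-prime q≢p)) (Equivalence.to (S′ q q-prime q≢p)))
      (combine (Equivalence.from (S q q-prime q≢p)) (Equivalence.from (S′ q q-prime q≢p)))
  where
  combine : ∀ {m m′ n n′} → (q ∣ m → q ∣ n) → (q ∣ m′ → q ∣ n′) → q ∣ m * m′ → q ∣ n * n′
  combine {m} {m′} {n} {n′} f f′ q∣mm′ =
    Sum.[ (λ q∣m → ∣m⇒∣m*n n′ (f q∣m)) , (λ q∣m′ → ∣n⇒∣m*n n (f′ q∣m′)) ]′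
      (euclidsLemma m m′ q-prime q∣mm′)

module _ {p e : ℕ} (p-prime : Prime p) where

  onlyPrimeDivisor-p : ∀ {u v} (d : Dependence (p ^ suc e) u v) → k₁ d ≢ + 0 → k₂ d ≡ + 0
                     → ∀ q → Prime q → q ∣ u → q ≡ p
  onlyPrimeDivisor-p d k₁≢0 k₂≡0 q q-prime q∣u with prime∣a⇒∣u⊎∣v (rotate d) q-prime q∣u k₁≢0
  ... | inj₁ (_ , k₂≢0) = ⊥-elim (k₂≢0 k₂≡0)
  ... | inj₂ (q∣a , _)  = prime∣p^n⇒≡p (suc e) q-prime p-prime q∣a

  sharedPrimeDivisor : ∀ {u v q} (d : Dependence (p ^ suc e) u v) → k₁ d ≢ + 0
                     → Prime q → q ≢ p → q ∣ u → q ∣ v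
  sharedPrimeDivisor d k₁≢0 q-prime q≢p q∣u with prime∣a⇒∣u⊎∣v (rotate d) q-prime q∣u k₁≢0
  ... | inj₁ (q∣v , _) = q∣v
  ... | inj₂ (q∣a , _) = ⊥-elim (q≢p (prime∣p^n⇒≡p (suc e) q-prime p-prime q∣a))

  dependence⇒power⊎samePrimeDivisors : ∀ {u v} → u ≢ 0 → v ≢ 0 → Dependence (p ^ suc e) u v
    → (∃[ i ] u ≡ p ^ i) ⊎ (∃[ i ] v ≡ p ^ i) ⊎ SamePrimeDivisorsExcept p u v
  dependence⇒power⊎samePrimeDivisors u≢0 v≢0 d with k₁ d ℤ.≟ + 0 | k₂ d ℤ.≟ + 0
  ... | yes k₁≡0 | yes k₂≡0 = ⊥-elim (¬k₁≡0×k₂≡0 d p-prime (m∣m*n (p ^ e)) (k₁≡0 , k₂≡0))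
  ... | no  k₁≢0 | yes k₂≡0 = inj₁ (onlyPrimeDivisor⇒power u≢0 (onlyPrimeDivisor-p d k₁≢0 k₂≡0))
  ... | yes k₁≡0 | no  k₂≢0 =
          inj₂ (inj₁ (onlyPrimeDivisor⇒power v≢0 (onlyPrimeDivisor-p (swap₁₂ d) k₂≢0 k₁≡0)))
  ... | no  k₁≢0 | no  k₂≢0 = inj₂ (inj₂ λ q q-prime q≢p →
          mk⇔ (sharedPrimeDivisor d k₁≢0 q-prime q≢p) (sharedPrimeDivisor (swap₁₂ d) k₂≢0 q-prime q≢p))

balanced⇒u^x≡v^y : ∀ {a u v e₀ e₀′ x x′ y y′} → e₀ ≡ 0 → e₀′ ≡ 0 → x′ ≡ 0 → y ≡ 0
                 → a ^ e₀ * (u ^ x * v ^ y) ≡ a ^ e₀′ * (u ^ x′ * v ^ y′) → u ^ x ≡ v ^ y′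
balanced⇒u^x≡v^y {u = u} {v} {x = x} {y′ = y′} refl refl refl refl eq = begin
  u ^ x            ≡⟨ *-identityʳ (u ^ x) ⟨
  u ^ x * 1        ≡⟨ *-identityˡ (u ^ x * 1) ⟨
  1 * (u ^ x * 1)  ≡⟨ eq ⟩
  1 * (1 * v ^ y′) ≡⟨ *-identityˡ (1 * v ^ y′) ⟩
  1 * v ^ y′       ≡⟨ *-identityˡ (v ^ y′) ⟩
  v ^ y′           ∎
  where open ≡-Reasoning

module _ {p : ℕ} (p-prime : Prime p) where

  p∤u,v⇒k₀≡0 : ∀ {u v} → ¬ p ∣ u → ¬ p ∣ v → (d : Dependence p u v) → k₀ d ≡ + 0
  p∤u,v⇒k₀≡0 p∤u p∤v d with k₀ d ℤ.≟ + 0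
  ... | yes k₀≡0 = k₀≡0
  ... | no  k₀≢0 with prime∣a⇒∣u⊎∣v d p-prime ∣-refl k₀≢0
  ...   | inj₁ (p∣u , _) = ⊥-elim (p∤u p∣u)
  ...   | inj₂ (p∣v , _) = ⊥-elim (p∤v p∣v)

  equalPowers⁺ : ∀ {u v} → ¬ p ∣ u → ¬ p ∣ v → 2 ≤ u → (d : Dependence p u v) → k₁ d ⁺ ≢ 0
               → ∃[ x ] ∃[ y ] 1 ≤ x × 1 ≤ y × u ^ x ≡ v ^ y
  equalPowers⁺ p∤u p∤v u≥2 d k₁⁺≢0 with primeDivisor u≥2
  ... | q , q-prime , q∣u with prime∣a⇒∣u⁻⊎∣v⁻ (rotate d) q-prime q∣u k₁⁺≢0
  ...   | inj₂ (_ , k₀⁻≢0) = ⊥-elim (k₀⁻≢0 (cong _⁻ (p∤u,v⇒k₀≡0 p∤u p∤v d)))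
  ...   | inj₁ (_ , k₂⁻≢0) = k₁ d ⁺ , k₂ d ⁻ , n≢0⇒n>0 k₁⁺≢0 , n≢0⇒n>0 k₂⁻≢0 ,
          balanced⇒u^x≡v^y {x = k₁ d ⁺} {y′ = k₂ d ⁻}
            (cong _⁺ (p∤u,v⇒k₀≡0 p∤u p∤v d)) (cong _⁻ (p∤u,v⇒k₀≡0 p∤u p∤v d))
            (⁺≢0⇒⁻≡0 (k₁ d) k₁⁺≢0) (⁻≢0⇒⁺≡0 (k₂ d) k₂⁻≢0) (balanced d)

  equalPowers : ∀ {u v} → ¬ p ∣ u → ¬ p ∣ v → 2 ≤ u → 2 ≤ v → Dependence p u v
              → ∃[ x ] ∃[ y ] 1 ≤ x × 1 ≤ y × u ^ x ≡ v ^ y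
  equalPowers p∤u p∤v u≥2 v≥2 d with ≢0⇒⁺≢0⊎⁻≢0 (k₀≡0⇒k₁≢0 d v≥2 (p∤u,v⇒k₀≡0 p∤u p∤v d))
  ... | inj₁ k₁⁺≢0 = equalPowers⁺ p∤u p∤v u≥2 d k₁⁺≢0
  ... | inj₂ k₁⁻≢0 =
    equalPowers⁺ p∤u p∤v u≥2 (negate d) (λ eq → k₁⁻≢0 (trans (sym (⁺-neg (k₁ d))) eq))

-- The triples (2, b, c), (3, b + 1, c + 1) and (4, b + 2, c + 2)

3∣n⊎3∣1+n⊎3∣2+n : ∀ n → 3 ∣ n ⊎ 3 ∣ 1 + n ⊎ 3 ∣ 2 + n
3∣n⊎3∣1+n⊎3∣2+n zero = inj₁ (divides 0 refl)
3∣n⊎3∣1+n⊎3∣2+n (suc n) with 3∣n⊎3∣1+n⊎3∣2+n n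
... | inj₁ 3∣n          = inj₂ (inj₂ (∣m∣n⇒∣m+n (∣-refl {3}) 3∣n))
... | inj₂ (inj₁ 3∣1+n) = inj₁ 3∣1+n
... | inj₂ (inj₂ 3∣2+n) = inj₂ (inj₁ 3∣2+n)

3∤c+1 : ∀ {b c} → SamePrimeDivisorsExcept 2 b c → SamePrimeDivisorsExcept 2 (b + 2) (c + 2)
      → ¬ 3 ∣ b + 1 → ¬ 3 ∣ c + 1
3∤c+1 {b} {c} S S₂ 3∤b+1 3∣c+1 = excluded (3∣n⊎3∣1+n⊎3∣2+n b)
  where
  3≢1 : 3 ≢ 1
  3≢1 ()
  to : ∀ {u v} → SamePrimeDivisorsExcept 2 u v → 3 ∣ u → 3 ∣ v
  to S = Equivalence.to (S 3 prime[3] λ ())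
  excluded : ¬ (3 ∣ b ⊎ 3 ∣ 1 + b ⊎ 3 ∣ 2 + b)
  excluded (inj₁ 3∣b)          = 3≢1 (∣n∣1+n⇒≡1 (to S 3∣b) (subst (3 ∣_) (+-comm c 1) 3∣c+1))
  excluded (inj₂ (inj₁ 3∣1+b)) = 3∤b+1 (subst (3 ∣_) (+-comm 1 b) 3∣1+b)
  excluded (inj₂ (inj₂ 3∣2+b)) =
    3≢1 (∣n∣1+n⇒≡1 3∣c+1 (subst (3 ∣_) (+-suc c 1) (to S₂ (subst (3 ∣_) (+-comm 2 b) 3∣2+b))))

[n+1]²∸1≡n*[n+2] : ∀ {n w} k → n + 1 ≡ w ^ k → (w * w) ^ k ∸ 1 ≡ n * (n + 2)
[n+1]²∸1≡n*[n+2] {n} {w} k n+1≡w^k = begin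
  (w * w) ^ k ∸ 1        ≡⟨ cong (_∸ 1) (^-distribʳ-* w w k) ⟩
  w ^ k * w ^ k ∸ 1      ≡⟨ cong (λ x → x * x ∸ 1) n+1≡w^k ⟨
  (n + 1) * (n + 1) ∸ 1  ≡⟨ cong (_∸ 1) (algebra n) ⟩
  n * (n + 2)            ∎
  where
  open ≡-Reasoning
  algebra : ∀ n → (n + 1) * (n + 1) ≡ 1 + n * (n + 2)
  algebra = solve-∀

even⊎odd : ∀ n → 2 ∣ n ⊎ ∃[ h ] n ≡ 1 + h * 2
even⊎odd zero    = inj₁ (divides 0 refl)
even⊎odd (suc n) with even⊎odd n
... | inj₁ (divides h refl) = inj₂ (h , refl)
... | inj₂ (h , refl)       = inj₁ (divides (suc h) refl)

4∣m*m∸1 : ∀ {m} → ¬ 2 ∣ m → 4 ∣ m * m ∸ 1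
4∣m*m∸1 {m} 2∤m with even⊎odd m
... | inj₁ 2∣m        = ⊥-elim (2∤m 2∣m)
... | inj₂ (h , refl) = divides (h * h + h) (cong (_∸ 1) (algebra h))
  where
  algebra : ∀ h → (1 + h * 2) * (1 + h * 2) ≡ 1 + (h * h + h) * 4
  algebra = solve-∀

2≤m^n⇒2≤m : ∀ m n → 2 ≤ m ^ n → 2 ≤ m
2≤m^n⇒2≤m zero          zero (s≤s ())
2≤m^n⇒2≤m (suc zero)    n    2≤1^n = ⊥-elim (<-irrefl refl (subst (1 <_) (^-zeroˡ n) 2≤1^n))
2≤m^n⇒2≤m (suc (suc m)) n    _     = s≤s (s≤s z≤n)

¬[1+b]^x≡[1+c]^y : ∀ {b c x y} → 1 ≤ b → b < c → 1 ≤ x → 1 ≤ y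
                 → SamePrimeDivisorsExcept 2 (b * (b + 2)) (c * (c + 2))
                 → (b + 1) ^ x ≢ (c + 1) ^ y
¬[1+b]^x≡[1+c]^y {b} {c} b≥1 b<c x≥1 y≥1 same eq =
  ^∸1-hasNewPrimeDivisor W≥2 j≥2 2∣W∸1⇒4∣W∸1 fromW∸1
  where
  open PowersOfCommonBase
    (powersOfCommonBase (+-monoˡ-≤ 1 b≥1) (+-monoˡ-≤ 1 (≤-trans b≥1 (<⇒≤ b<c))) x≥1 y≥1 eq)
  w W : ℕ
  w = base
  W = w * w
  w≥2 : 2 ≤ w
  w≥2 = 2≤m^n⇒2≤m w i (subst (2 ≤_) B≡base^i (+-monoˡ-≤ 1 b≥1))
  instance
    w≢0 : NonZero w
    w≢0 = >-nonZero (≤-trans (s≤s z≤n) w≥2)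
    W≢0 : NonZero W
    W≢0 = m*n≢0 w w
  W≥2 : 2 ≤ W
  W≥2 = ≤-trans w≥2 (m≤m*n w w)
  i<j : i < j
  i<j = ≰⇒> λ j≤i →
    <⇒≱ (+-monoˡ-< 1 b<c) (subst₂ _≤_ (sym C≡base^j) (sym B≡base^i) (^-monoʳ-≤ w j≤i))
  j≥2 : 2 ≤ j
  j≥2 = ≤-trans (s≤s (proj₁ (reachable⇒≥1 reachable))) i<j
  w-odd : ∀ {m} .{{_ : NonZero m}} → 2 ∣ m ∸ 1 → (2 ∣ w → 2 ∣ m) → ¬ 2 ∣ w
  w-odd 2∣m∸1 2∣m 2∣w with ∣m∣m∸1⇒≡1 (2∣m 2∣w) 2∣m∸1
  ... | ()
  2∣W∸1⇒4∣W∸1 : 2 ∣ W ∸ 1 → 4 ∣ W ∸ 1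
  2∣W∸1⇒4∣W∸1 2∣W∸1 = 4∣m*m∸1 (w-odd 2∣W∸1 (∣m⇒∣m*n w))
  fromW∸1 : ∀ q → Prime q → q ∣ W ^ j ∸ 1 → q ∣ W ∸ 1
  fromW∸1 q q-prime q∣W^j∸1 with q ≟ 2
  ... | yes refl = ∣-trans (divides 2 refl)
                     (4∣m*m∸1 (w-odd {{m^n≢0 W j}} q∣W^j∸1
                                (λ 2∣w → ∣m⇒∣m^n j (∣m⇒∣m*n w 2∣w) (m<n⇒n≢0 j≥2))))
  ... | no  q≢2  = ∣^∸1-reachable reachable
                     (subst (q ∣_) (sym ([n+1]²∸1≡n*[n+2] i B≡base^i))
                       (Equivalence.from (same q q-prime q≢2)
                          (subst (q ∣_) ([n+1]²∸1≡n*[n+2] j C≡base^j) q∣W^j∸1)))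
                     q∣W^j∸1

¬dependence[3,b+1,c+1] : ∀ {b c} → 2 < b → 2 < c → b ≢ c
                        → SamePrimeDivisorsExcept 2 b c → SamePrimeDivisorsExcept 2 (b + 2) (c + 2)
                        → ¬ 3 ∣ b + 1 ⊎ ¬ 3 ∣ c + 1 → ¬ Dependence 3 (b + 1) (c + 1)
¬dependence[3,b+1,c+1] {b} {c} 2<b 2<c b≢c S S₂ 3∤b+1⊎3∤c+1 d = byOrder (<-cmp b c)
  where
  b≥1 : 1 ≤ b
  b≥1 = ≤-trans (s≤s z≤n) 2<b
  c≥1 : 1 ≤ c
  c≥1 = ≤-trans (s≤s z≤n) 2<c
  S′ : SamePrimeDivisorsExcept 2 c b
  S′ = samePrimeDivisors-sym S
  S₂′ : SamePrimeDivisorsExcept 2 (c + 2) (b + 2)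
  S₂′ = samePrimeDivisors-sym S₂
  powers : ∃[ x ] ∃[ y ] 1 ≤ x × 1 ≤ y × (b + 1) ^ x ≡ (c + 1) ^ y
  powers = equalPowers prime[3]
             (Sum.[ id , 3∤c+1 S′ S₂′ ]′ 3∤b+1⊎3∤c+1) (Sum.[ 3∤c+1 S S₂ , id ]′ 3∤b+1⊎3∤c+1)
             (+-monoˡ-≤ 1 b≥1) (+-monoˡ-≤ 1 c≥1) d
  byOrder : Tri (b < c) (b ≡ c) (c < b) → ⊥
  byOrder (tri< b<c _ _) = let x , y , x≥1 , y≥1 , eq = powers in
    ¬[1+b]^x≡[1+c]^y b≥1 b<c x≥1 y≥1 (samePrimeDivisors-* S S₂) eq
  byOrder (tri≈ _ b≡c _) = b≢c b≡c
  byOrder (tri> _ _ c<b) = let x , y , x≥1 , y≥1 , eq = powers in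
    ¬[1+b]^x≡[1+c]^y c≥1 c<b y≥1 x≥1 (samePrimeDivisors-* S′ S₂′) (sym eq)

lemma9 : (b c : ℕ) → 2 < b → 2 < c → b ≢ c
       → MultDep3 2 b c → MultDep3 3 (b + 1) (c + 1) → MultDep3 4 (b + 2) (c + 2)
       → (¬ (3 ∣ b + 1)) ⊎ (¬ (3 ∣ c + 1))
       → IsPowerOf2 b ⊎ IsPowerOf2 c ⊎ IsPowerOf2 (b + 2) ⊎ IsPowerOf2 (c + 2)
lemma9 b c 2<b 2<c b≢c dep₂ dep₃ dep₄ 3∤b+1⊎3∤c+1
  with dependence⇒power⊎samePrimeDivisors {e = 0} prime[2] (m<n⇒n≢0 2<b) (m<n⇒n≢0 2<c) (fromMultDep3 dep₂)
     | dependence⇒power⊎samePrimeDivisors {e = 1} prime[2]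
         (m<n⇒n≢0 (m≤n⇒m≤n+o 2 2<b)) (m<n⇒n≢0 (m≤n⇒m≤n+o 2 2<c)) (fromMultDep3 dep₄)
... | inj₁ b≡2^i        | _                   = inj₁ b≡2^i
... | inj₂ (inj₁ c≡2^i) | _                   = inj₂ (inj₁ c≡2^i)
... | _                 | inj₁ b+2≡2^i        = inj₂ (inj₂ (inj₁ b+2≡2^i))
... | _                 | inj₂ (inj₁ c+2≡2^i) = inj₂ (inj₂ (inj₂ c+2≡2^i))
... | inj₂ (inj₂ S)     | inj₂ (inj₂ S₂)      =
  ⊥-elim (¬dependence[3,b+1,c+1] 2<b 2<c b≢c S S₂ 3∤b+1⊎3∤c+1 (fromMultDep3 dep₃))
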